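{- Let $h=(h_j)_{j\ge1}$ be any sequence of positive integers and write $S(j,1)=S_h(j,1)$, $S(j,0)=S_h(j,0)$. Then: (a) $S(j,1)=1\,S(1,0)\cdots S(j,0)$ for all $j\ge0$ (for $j=0$ this reads $S(0,1)=1$); $S(0,0)\cdots S(j-1,0)\to S(j,1)$ for all $j\ge1$; $S(0,0)\cdots S(j-1,0)\to S(j,0)$ whenever $h_j\ge2$; and $S(j,0)<S(j,1)$ for all $j\ge0$. (b) If $A_j\to S(j,1)$ for some nonempty block $A_j$, then $A_j\le S(j,1)$. (c) If $B_j\to S(j,0)$ for some nonempty block $B_j$, then $B_j\le S(j,0)$.
   Context: Blocks are finite words over $\{0,1\}$; juxtaposition denotes concatenation and $B^k$ the $k$-fold concatenation ($B^0$ empty). For a sequence $h=(h_j)$ of positive integers define $S_h(0,1):=1$, $S_h(0,0):=0$ and for $j\ge1$: $S_h(j,1):=S_h(j-1,1)^{h_j}S_h(j-1,0)$, $S_h(j,0):=S_h(j-1,1)^{h_j-1}S_h(j-1,0)$. For blocks $A,B$: $A\to B$ means that $B$ ends with $A$ ($A$ is a suffix of $B$); $A<B$ means $Aa_1a_2\cdots<Bb_1b_2\cdots$ in the lexicographic order for all sequences $(a_i),(b_i)$ of zeros and ones; $A\le B$ means $A<B$ or $A=B$. -}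

module Defs where

open import Data.Bool using (Bool; true; false)
open import Data.Nat using (ℕ; zero; suc; _∸_; _<_)
open import Data.List using (List; []; _∷_; _++_; concat; replicate)
open import Data.Product using (∃; _×_)
open import Data.Sum using (_⊎_)
open import Relation.Binary.PropositionalEquality using (_≡_)

-- Blocks: finite words over {0,1}, with false = 0 and true = 1.
Block : Set
Block = List Bool

_^^_ : Block → ℕ → Block
B ^^ k = concat (replicate k B)

-- S h j e = S_h(j,e), with e = true for 1 and e = false for 0.
-- h is indexed from 1 (h 0 is never used).
S : (ℕ → ℕ) → ℕ → Bool → Block
S h zero    true  = true ∷ []
S h zero    false = false ∷ []
S h (suc j) true  = (S h j true ^^ h (suc j)) ++ S h j false
S h (suc j) false = (S h j true ^^ (h (suc j) ∸ 1)) ++ S h j false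

seg : (ℕ → ℕ) → ℕ → ℕ → Block
seg h m zero    = []
seg h m (suc k) = S h m false ++ seg h (suc m) k

-- A ⇝ B : B ends with A (A is a suffix of B)   ("A → B" in the paper)
_⇝_ : Block → Block → Set
A ⇝ B = ∃ λ C → C ++ A ≡ B

Seq : Set
Seq = ℕ → Bool

_<ₛ_ : Seq → Seq → Set
x <ₛ y = ∃ λ n → (∀ i → i < n → x i ≡ y i) × (x n ≡ false) × (y n ≡ true)

_⊙_ : Block → Seq → Seq
([] ⊙ a) i = a i
((b ∷ B) ⊙ a) zero = b
((b ∷ B) ⊙ a) (suc i) = (B ⊙ a) i

_<ᵇ_ : Block → Block → Set
A <ᵇ B = ∀ (a b : Seq) → (A ⊙ a) <ₛ (B ⊙ b)

_≤ᵇ_ : Block → Block → Set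
A ≤ᵇ B = A <ᵇ B ⊎ A ≡ B

{-# OPTIONS --safe #-}
-- Write X = S(j,1) and Y = S(j,0), so that S(j+1,1) and S(j+1,0) are both of the form
-- Xⁿ Y with n ≥ 1 resp. n ≥ 0. Call a block suffix-maximal if it dominates each of its
-- nonempty suffixes in the "first difference is 0 versus 1" order ≺. If X and Y are
-- suffix-maximal and Y ≺ X, then Xⁿ Y ≺ X Xⁿ Y (induct on n, starting from Y ≺ X), and a
-- nonempty suffix of X Xⁿ Y is either a suffix of Xⁿ Y, hence ≼ Xⁿ Y ≺ X Xⁿ Y, or has the
-- form A' Xⁿ Y with A' a suffix of X, hence A' ≼ X. So Xⁿ Y is again suffix-maximal,
-- and induction on j gives (b), (c) and S(j,0) ≺ S(j,1); a first difference 0 versus 1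
-- decides the order of the infinite continuations, which is the paper's order <.
module Submission where

open import Defs
open import Data.Bool using (true; false)
open import Data.Nat using (ℕ; zero; suc; _+_; _∸_; _≤_; _<_; z≤n; s≤s)
open import Data.Nat.Properties using (+-identityʳ; +-suc)
open import Data.List using (List; []; _∷_; _++_)
open import Data.List.Properties using (++-assoc; ++-identityʳ; ++-conicalʳ; ∷-injectiveʳ)
open import Data.Product using (_×_; _,_; proj₁; proj₂; ∃)
open import Data.Sum using (_⊎_; inj₁; inj₂)
open import Data.Empty using (⊥-elim)
open import Relation.Binary.PropositionalEquality
  using (_≡_; _≢_; refl; sym; trans; cong; subst; module ≡-Reasoning)

infix 4 _≺_

data _≺_ : Block → Block → Set where
  here  : ∀ {A B} → false ∷ A ≺ true ∷ B
  there : ∀ {b A B} → A ≺ B → b ∷ A ≺ b ∷ B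

≺-trans : ∀ {A B C} → A ≺ B → B ≺ C → A ≺ C
≺-trans here      (there q) = here
≺-trans (there p) here      = here
≺-trans (there p) (there q) = there (≺-trans p q)

≺-++ : ∀ {A B} Z W → A ≺ B → A ++ Z ≺ B ++ W
≺-++ Z W here      = here
≺-++ Z W (there p) = there (≺-++ Z W p)

≺-++ˡ : ∀ C {A B} → A ≺ B → C ++ A ≺ C ++ B
≺-++ˡ []      p = p
≺-++ˡ (c ∷ C) p = there (≺-++ˡ C p)

≺⇒<ᵇ : ∀ {A B} → A ≺ B → A <ᵇ B
≺⇒<ᵇ here      x y = zero , (λ i ()) , refl , refl
≺⇒<ᵇ (there {c} {A} {B} p) x y with ≺⇒<ᵇ p x y
... | n , agree , xₙ , yₙ = suc n , agree′ , xₙ , yₙ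
  where
  agree′ : ∀ i → i < suc n → ((c ∷ A) ⊙ x) i ≡ ((c ∷ B) ⊙ y) i
  agree′ zero    _         = refl
  agree′ (suc i) (s≤s i<n) = agree i i<n

≺⊎≡⇒≤ᵇ : ∀ {A B} → A ≺ B ⊎ A ≡ B → A ≤ᵇ B
≺⊎≡⇒≤ᵇ (inj₁ p) = inj₁ (≺⇒<ᵇ p)
≺⊎≡⇒≤ᵇ (inj₂ e) = inj₂ e

⇝-trans : ∀ {A B E} → A ⇝ B → B ⇝ E → A ⇝ E
⇝-trans {A} (C , refl) (D , refl) = D ++ C , ++-assoc D C A

⇝-++ʳ : ∀ {A B} Y → A ⇝ B → (A ++ Y) ⇝ (B ++ Y)
⇝-++ʳ {A} Y (C , refl) = C , sym (++-assoc C A Y)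

[]⇝ : ∀ B → [] ⇝ B
[]⇝ B = B , ++-identityʳ B

⇝-^^ : ∀ n X → X ⇝ (X ^^ suc n)
⇝-^^ zero    X = [] , sym (++-identityʳ X)
⇝-^^ (suc n) X with ⇝-^^ n X
... | C , C++X≡Xⁿ⁺¹ = X ++ C , trans (++-assoc X C X) (cong (X ++_) C++X≡Xⁿ⁺¹)

⇝-++-split : ∀ C A P Q → C ++ A ≡ P ++ Q →
  A ⇝ Q ⊎ ∃ λ A′ → A ≡ A′ ++ Q × A′ ≢ [] × A′ ⇝ P
⇝-++-split []      A []      Q eq = inj₁ ([] , eq)
⇝-++-split []      A (p ∷ P) Q eq = inj₂ (p ∷ P , eq , (λ ()) , [] , refl)
⇝-++-split (c ∷ C) A []      Q eq = inj₁ (c ∷ C , eq)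
⇝-++-split (c ∷ C) A (p ∷ P) Q eq with ⇝-++-split C A P Q (∷-injectiveʳ eq)
... | inj₁ A⇝Q                   = inj₁ A⇝Q
... | inj₂ (A′ , e , ne , D , d) = inj₂ (A′ , e , ne , p ∷ D , cong (p ∷_) d)

^^-suc-++ : ∀ n X Y → X ^^ suc n ++ Y ≡ X ++ (X ^^ n ++ Y)
^^-suc-++ n X Y = ++-assoc X (X ^^ n) Y

SuffixMaximal : Block → Set
SuffixMaximal B = ∀ A → A ≢ [] → A ⇝ B → A ≺ B ⊎ A ≡ B

[-]-suffixMaximal : ∀ b → SuffixMaximal (b ∷ [])
[-]-suffixMaximal b A ne ([]    , eq) = inj₂ eq
[-]-suffixMaximal b A ne (c ∷ C , eq) = ⊥-elim (ne (++-conicalʳ C A (∷-injectiveʳ eq)))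

X-++-suffixMaximal : ∀ {X} → SuffixMaximal X →
  ∀ W → SuffixMaximal W → W ≺ X ++ W → SuffixMaximal (X ++ W)
X-++-suffixMaximal {X} X-max W W-max W≺XW A ne (C , eq) with ⇝-++-split C A X W eq
... | inj₁ A⇝W with W-max A ne A⇝W
...   | inj₁ A≺W  = inj₁ (≺-trans A≺W W≺XW)
...   | inj₂ refl = inj₁ W≺XW
X-++-suffixMaximal {X} X-max W W-max W≺XW A ne (C , eq) | inj₂ (A′ , refl , ne′ , A′⇝X)
  with X-max A′ ne′ A′⇝X
... | inj₁ A′≺X = inj₁ (≺-++ W W A′≺X)
... | inj₂ refl = inj₂ refl

module PowerBlock {X Y : Block}
  (X-max : SuffixMaximal X) (Y-max : SuffixMaximal Y) (Y≺X : Y ≺ X) where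

  ^^-++-≺ : ∀ n → X ^^ n ++ Y ≺ X ++ (X ^^ n ++ Y)
  ^^-++-≺ zero    = subst (_≺ X ++ Y) (++-identityʳ Y) (≺-++ [] Y Y≺X)
  ^^-++-≺ (suc n) = subst (λ Z → Z ≺ X ++ Z) (sym (^^-suc-++ n X Y)) (≺-++ˡ X (^^-++-≺ n))

  ^^-++-suffixMaximal : ∀ n → SuffixMaximal (X ^^ n ++ Y)
  ^^-++-suffixMaximal zero    = Y-max
  ^^-++-suffixMaximal (suc n) = subst SuffixMaximal (sym (^^-suc-++ n X Y))
    (X-++-suffixMaximal X-max _ (^^-++-suffixMaximal n) (^^-++-≺ n))

module _ (h : ℕ → ℕ) (h-pos : ∀ j → 1 ≤ h (suc j)) where

  S-true-suc : ∀ j → S h (suc j) true ≡ S h j true ^^ suc (h (suc j) ∸ 1) ++ S h j false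
  S-true-suc j with h (suc j) | h-pos j
  ... | suc n | _ = refl

  S-suffixMaximal : ∀ j →
    SuffixMaximal (S h j true) × SuffixMaximal (S h j false) × S h j false ≺ S h j true
  S-suffixMaximal zero = [-]-suffixMaximal true , [-]-suffixMaximal false , here
  S-suffixMaximal (suc j) with S-suffixMaximal j
  ... | X-max , Y-max , Y≺X =
    subst SuffixMaximal (sym (S-true-suc j)) (^^-++-suffixMaximal (suc n)) ,
    ^^-++-suffixMaximal n ,
    subst (S h (suc j) false ≺_)
      (sym (trans (S-true-suc j) (^^-suc-++ n (S h j true) (S h j false))))
      (^^-++-≺ n)
    where
    n = h (suc j) ∸ 1
    open PowerBlock X-max Y-max Y≺X

  seg-snoc : ∀ m k → seg h m (suc k) ≡ seg h m k ++ S h (m + k) false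
  seg-snoc m zero    rewrite +-identityʳ m = ++-identityʳ (S h m false)
  seg-snoc m (suc k) rewrite +-suc m k     = begin
    S h m false ++ seg h (suc m) (suc k)
      ≡⟨ cong (S h m false ++_) (seg-snoc (suc m) k) ⟩
    S h m false ++ (seg h (suc m) k ++ S h (suc m + k) false)
      ≡⟨ ++-assoc (S h m false) (seg h (suc m) k) (S h (suc m + k) false) ⟨
    (S h m false ++ seg h (suc m) k) ++ S h (suc m + k) false
      ∎
    where open ≡-Reasoning

  S-true≡1∷seg : ∀ j → S h j true ≡ true ∷ seg h 1 j
  S-true≡1∷seg zero    = refl
  S-true≡1∷seg (suc j) = begin
    S h (suc j) true
      ≡⟨ S-true-suc j ⟩
    S h j true ^^ suc (h (suc j) ∸ 1) ++ S h j false
      ≡⟨ ^^-suc-++ (h (suc j) ∸ 1) (S h j true) (S h j false) ⟩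
    S h j true ++ S h (suc j) false
      ≡⟨ cong (_++ S h (suc j) false) (S-true≡1∷seg j) ⟩
    true ∷ seg h 1 j ++ S h (suc j) false
      ≡⟨ cong (true ∷_) (seg-snoc 1 j) ⟨
    true ∷ seg h 1 (suc j)
      ∎
    where open ≡-Reasoning

  seg⇝S-true : ∀ j → seg h 0 j ⇝ S h j true
  seg-suc⇝^^-++ : ∀ j n → seg h 0 (suc j) ⇝ (S h j true ^^ suc n ++ S h j false)

  seg⇝S-true zero    = []⇝ (true ∷ [])
  seg⇝S-true (suc j) =
    subst (seg h 0 (suc j) ⇝_) (sym (S-true-suc j)) (seg-suc⇝^^-++ j (h (suc j) ∸ 1))

  seg-suc⇝^^-++ j n = subst (_⇝ (S h j true ^^ suc n ++ S h j false)) (sym (seg-snoc 0 j))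
    (⇝-++ʳ (S h j false) (⇝-trans (seg⇝S-true j) (⇝-^^ n (S h j true))))

  seg⇝S-false : ∀ j → 2 ≤ h (suc j) → seg h 0 (suc j) ⇝ S h (suc j) false
  seg⇝S-false j h≥2 with h (suc j) | h≥2
  ... | suc (suc n) | _ = seg-suc⇝^^-++ j n
  ... | suc zero    | s≤s ()

lemma3p1 : (h : ℕ → ℕ) → (∀ j → 1 ≤ j → 1 ≤ h j) →
    ((∀ j → S h j true ≡ true ∷ seg h 1 j)
     × (∀ j → 1 ≤ j → seg h 0 j ⇝ S h j true)
     × (∀ j → 1 ≤ j → 2 ≤ h j → seg h 0 j ⇝ S h j false)
     × (∀ j → S h j false <ᵇ S h j true))
    × (∀ j (A : Block) → A ≢ [] → A ⇝ S h j true → A ≤ᵇ S h j true)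
    × (∀ j (B : Block) → B ≢ [] → B ⇝ S h j false → B ≤ᵇ S h j false)
lemma3p1 h h≥1 =
  ( S-true≡1∷seg h h-pos
  , (λ j _ → seg⇝S-true h h-pos j)
  , (λ { (suc j) _ h≥2 → seg⇝S-false h h-pos j h≥2 })
  , (λ j → ≺⇒<ᵇ (S-false≺S-true j)) )
  , (λ j A ne A⇝ → ≺⊎≡⇒≤ᵇ (S-true-max j A ne A⇝))
  , (λ j B ne B⇝ → ≺⊎≡⇒≤ᵇ (S-false-max j B ne B⇝))
  where
  h-pos : ∀ j → 1 ≤ h (suc j)
  h-pos j = h≥1 (suc j) (s≤s z≤n)

  S-true-max : ∀ j → SuffixMaximal (S h j true)
  S-true-max j = proj₁ (S-suffixMaximal h h-pos j)

  S-false-max : ∀ j → SuffixMaximal (S h j false)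
  S-false-max j = proj₁ (proj₂ (S-suffixMaximal h h-pos j))

  S-false≺S-true : ∀ j → S h j false ≺ S h j true
  S-false≺S-true j = proj₂ (proj₂ (S-suffixMaximal h h-pos j))
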